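{- Let $\mathcal D$ be an $\alpha$-resolvable $2$-$(v,k,\lambda)$ design with replication number $r$, and let $\rho=r/\alpha$ be the number of $\alpha$-resolution classes. If $\rho>1$ is odd, then $\mathcal D$ has a zero-sum $3$-flow; if $\rho$ is even, then $\mathcal D$ has a zero-sum $2$-flow.
   Context: A $2$-$(v,k,\lambda)$ design is a pair $(X,\mathcal B)$ with $X$ a set of $v$ points and $\mathcal B$ a collection of $k$-subsets (blocks) such that every $2$-subset of $X$ lies in exactly $\lambda$ blocks; each point then lies in exactly $r$ blocks. An $\alpha$-resolution class is a subcollection of blocks containing every point exactly $\alpha$ times; the design is $\alpha$-resolvable if $\mathcal B$ can be partitioned into $\alpha$-resolution classes (there are then $\rho=r/\alpha$ of them). For a positive integer $n$, a zero-sum $n$-flow is a map $f:\mathcal B\to\{\pm1,\dots,\pm(n-1)\}$ with $\sum_{B\ni x} f(B)=0$ for every point $x$. -}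

module Defs where

open import Data.Nat using (ℕ; zero; suc; _+_; _∸_; _≤_)
open import Data.Integer as ℤ using (ℤ)
open import Data.Fin using (Fin; zero; suc)
open import Data.Fin.Subset using (Subset; _∈_; ∣_∣)
open import Data.Fin.Subset.Properties using (_∈?_)
open import Data.Product using (_×_)
open import Relation.Nullary using (Dec; yes; no; ¬_)
open import Relation.Nullary.Decidable using (_×-dec_)
open import Relation.Binary.PropositionalEquality using (_≡_)
import Data.Fin.Properties as FinP

count : ∀ {b} {P : Fin b → Set} → ((i : Fin b) → Dec (P i)) → ℕ
count {zero}  d = 0
count {suc b} d with d zero
... | yes _ = suc (count (λ i → d (suc i)))
... | no  _ = count (λ i → d (suc i))

sumWhere : ∀ {b} {P : Fin b → Set} → ((i : Fin b) → Dec (P i)) → (Fin b → ℤ) → ℤ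
sumWhere {zero}  d f = ℤ.0ℤ
sumWhere {suc b} d f with d zero
... | yes _ = f zero ℤ.+ sumWhere (λ i → d (suc i)) (λ i → f (suc i))
... | no  _ = sumWhere (λ i → d (suc i)) (λ i → f (suc i))

-- A design on point set Fin v with b blocks (a multiset of blocks, indexed by Fin b).
Is2Design : (v k λ' b : ℕ) → (Fin b → Subset v) → Set
Is2Design v k λ' b B =
  ((j : Fin b) → ∣ B j ∣ ≡ k) ×
  ((x y : Fin v) → ¬ (x ≡ y) → count (λ j → (x ∈? B j) ×-dec (y ∈? B j)) ≡ λ')

HasReplication : (v b r : ℕ) → (Fin b → Subset v) → Set
HasReplication v b r B = (x : Fin v) → count (λ j → x ∈? B j) ≡ r

-- cls : Fin b → Fin ρ is a partition of the blocks into ρ α-resolution classes: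
-- each class contains every point exactly α times.
IsAlphaResolution : (v b α ρ : ℕ) → (Fin b → Subset v) → (Fin b → Fin ρ) → Set
IsAlphaResolution v b α ρ B cls =
  (c : Fin ρ) (x : Fin v) →
    count (λ j → (cls j FinP.≟ c) ×-dec (x ∈? B j)) ≡ α

IsZeroSumFlow : (n v b : ℕ) → (Fin b → Subset v) → (Fin b → ℤ) → Set
IsZeroSumFlow n v b B f =
  ((j : Fin b) → (1 ≤ ℤ.∣ f j ∣) × (ℤ.∣ f j ∣ ≤ n ∸ 1)) ×
  ((x : Fin v) → sumWhere (λ j → x ∈? B j) f ≡ ℤ.0ℤ)

-- Constant weights on the resolution classes give a flow: if class c carries
-- weight h c, the blocks through a point x contribute α · Σ_c h c, because x
-- lies in exactly α blocks of every class. So it suffices to find nonzero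
-- integers h 1, …, h ρ of absolute value at most n − 1 summing to 0: the
-- alternating weights ±1 when ρ is even, and −2, 1, 1 followed by alternating
-- ±1 when ρ ≥ 3 is odd.
module Submission where

open import Defs
open import Data.Nat using (ℕ; _*_; _≤_; _<_)
open import Data.Nat.Divisibility using (_∣_)
open import Relation.Nullary using (¬_)
open import Data.Integer using (ℤ)
open import Data.Fin using (Fin)
open import Data.Fin.Subset using (Subset)
open import Data.Product using (Σ; _×_)
open import Relation.Binary.PropositionalEquality using (_≡_)

open import Data.Bool using (if_then_else_)
open import Data.Nat using (zero; suc; _+_; _∸_; z≤n; s≤s)
open import Data.Nat.Divisibility using (divides)
open import Data.Nat.DivMod using (_%_; _/_; m≡m%n+[m/n]*n; m%n<n)
import Data.Nat.Properties as ℕ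
open import Data.Integer using (+_; -_; 0ℤ; 1ℤ; ∣_∣) renaming (_+_ to _+ℤ_; _*_ to _*ℤ_)
import Data.Integer.Properties as ℤ
open import Algebra.Properties.Semiring.Sum ℤ.+-*-semiring using (sum; sum-syntax; ∑-comm; sum-cong-≗; sum-replicate-zero; *-distribˡ-sum; *-distribʳ-sum)
open import Data.Fin using (zero; suc)
open import Data.Fin.Properties using (_≟_)
open import Data.Fin.Subset.Properties using (_∈?_)
open import Data.Product using (_,_)
open import Data.Empty using (⊥-elim)
open import Relation.Nullary using (Dec; does; yes; no)
open import Relation.Nullary.Decidable using (_×-dec_)
open import Relation.Binary.PropositionalEquality using (refl; sym; trans; cong; cong₂; module ≡-Reasoning)
open ≡-Reasoning

indicator : ∀ {p} {P : Set p} → Dec P → ℤ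
indicator d = if does d then 1ℤ else 0ℤ

indicator-×-dec : ∀ {p q} {P : Set p} {Q : Set q} (d : Dec P) (e : Dec Q) →
  indicator (d ×-dec e) ≡ indicator d *ℤ indicator e
indicator-×-dec (yes _) e = sym (ℤ.*-identityˡ (indicator e))
indicator-×-dec (no _)  e = refl

∑-select : ∀ {n} (h : Fin n → ℤ) (a : Fin n) → ∑[ c < n ] (h c *ℤ indicator (a ≟ c)) ≡ h a
∑-select {suc n} h zero = begin
  h zero *ℤ 1ℤ +ℤ ∑[ c < n ] (h (suc c) *ℤ 0ℤ)
    ≡⟨ cong₂ _+ℤ_ (ℤ.*-identityʳ (h zero)) (trans (sum-cong-≗ (λ c → ℤ.*-zeroʳ (h (suc c)))) (sum-replicate-zero n)) ⟩
  h zero +ℤ 0ℤ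
    ≡⟨ ℤ.+-identityʳ (h zero) ⟩
  h zero ∎
∑-select {suc n} h (suc a) = begin
  h zero *ℤ 0ℤ +ℤ ∑[ c < n ] (h (suc c) *ℤ indicator (a ≟ c))
    ≡⟨ cong₂ _+ℤ_ (ℤ.*-zeroʳ (h zero)) (∑-select (λ c → h (suc c)) a) ⟩
  0ℤ +ℤ h (suc a)
    ≡⟨ ℤ.+-identityˡ (h (suc a)) ⟩
  h (suc a) ∎

sumWhere-as-∑ : ∀ {b} {P : Fin b → Set} (d : (j : Fin b) → Dec (P j)) (f : Fin b → ℤ) →
  sumWhere d f ≡ ∑[ j < b ] (f j *ℤ indicator (d j))
sumWhere-as-∑ {zero}  d f = refl
sumWhere-as-∑ {suc b} d f with d zero
... | yes _ = cong₂ _+ℤ_ (sym (ℤ.*-identityʳ (f zero))) (sumWhere-as-∑ (λ j → d (suc j)) (λ j → f (suc j)))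
... | no  _ = trans (sumWhere-as-∑ (λ j → d (suc j)) (λ j → f (suc j)))
                    (sym (trans (cong₂ _+ℤ_ (ℤ.*-zeroʳ (f zero)) refl) (ℤ.+-identityˡ _)))

count-as-∑ : ∀ {b} {P : Fin b → Set} (d : (j : Fin b) → Dec (P j)) →
  + count d ≡ ∑[ j < b ] indicator (d j)
count-as-∑ {zero}  d = refl
count-as-∑ {suc b} d with d zero
... | yes _ = trans (ℤ.pos-+ 1 (count (λ j → d (suc j)))) (cong (1ℤ +ℤ_) (count-as-∑ (λ j → d (suc j))))
... | no  _ = trans (count-as-∑ (λ j → d (suc j))) (sym (ℤ.+-identityˡ _))

sumWhere-by-class : ∀ {b ρ} {P : Fin b → Set} (d : (j : Fin b) → Dec (P j))
  (cls : Fin b → Fin ρ) (h : Fin ρ → ℤ) →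
  sumWhere d (λ j → h (cls j)) ≡ ∑[ c < ρ ] (h c *ℤ + count (λ j → (cls j ≟ c) ×-dec d j))
sumWhere-by-class {b} {ρ} d cls h = begin
  sumWhere d (λ j → h (cls j))
    ≡⟨ sumWhere-as-∑ d (λ j → h (cls j)) ⟩
  ∑[ j < b ] (h (cls j) *ℤ indicator (d j))
    ≡⟨ sum-cong-≗ (λ j → cong (_*ℤ indicator (d j)) (sym (∑-select h (cls j)))) ⟩
  ∑[ j < b ] (∑[ c < ρ ] (h c *ℤ indicator (cls j ≟ c)) *ℤ indicator (d j))
    ≡⟨ sum-cong-≗ (λ j → *-distribʳ-sum (indicator (d j)) (λ c → h c *ℤ indicator (cls j ≟ c))) ⟩
  ∑[ j < b ] ∑[ c < ρ ] (h c *ℤ indicator (cls j ≟ c) *ℤ indicator (d j))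
    ≡⟨ ∑-comm (λ j c → h c *ℤ indicator (cls j ≟ c) *ℤ indicator (d j)) ⟩
  ∑[ c < ρ ] ∑[ j < b ] (h c *ℤ indicator (cls j ≟ c) *ℤ indicator (d j))
    ≡⟨ sum-cong-≗ (λ c → sum-cong-≗ (λ j → trans (ℤ.*-assoc (h c) _ _)
         (cong (h c *ℤ_) (sym (indicator-×-dec (cls j ≟ c) (d j)))))) ⟩
  ∑[ c < ρ ] ∑[ j < b ] (h c *ℤ indicator ((cls j ≟ c) ×-dec d j))
    ≡⟨ sum-cong-≗ (λ c → sym (*-distribˡ-sum (h c) (λ j → indicator ((cls j ≟ c) ×-dec d j)))) ⟩
  ∑[ c < ρ ] (h c *ℤ ∑[ j < b ] indicator ((cls j ≟ c) ×-dec d j))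
    ≡⟨ sum-cong-≗ (λ c → cong (h c *ℤ_) (sym (count-as-∑ (λ j → (cls j ≟ c) ×-dec d j)))) ⟩
  ∑[ c < ρ ] (h c *ℤ + count (λ j → (cls j ≟ c) ×-dec d j)) ∎

IsZeroSumWeighting : (n ρ : ℕ) → (Fin ρ → ℤ) → Set
IsZeroSumWeighting n ρ h = ((c : Fin ρ) → (1 ≤ ∣ h c ∣) × (∣ h c ∣ ≤ n ∸ 1)) × sum h ≡ 0ℤ

resolution-weighting⇒flow : ∀ {n v b α ρ} (B : Fin b → Subset v) (cls : Fin b → Fin ρ) {h : Fin ρ → ℤ} →
  IsAlphaResolution v b α ρ B cls → IsZeroSumWeighting n ρ h →
  IsZeroSumFlow n v b B (λ j → h (cls j))
resolution-weighting⇒flow {α = α} {ρ} B cls {h} resolution (bounded , balanced) =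
  (λ j → bounded (cls j)) , pointSum
  where
  pointSum : ∀ x → sumWhere (λ j → x ∈? B j) (λ j → h (cls j)) ≡ 0ℤ
  pointSum x = begin
    sumWhere (λ j → x ∈? B j) (λ j → h (cls j))
      ≡⟨ sumWhere-by-class (λ j → x ∈? B j) cls h ⟩
    ∑[ c < ρ ] (h c *ℤ + count (λ j → (cls j ≟ c) ×-dec (x ∈? B j)))
      ≡⟨ sum-cong-≗ (λ c → cong (λ m → h c *ℤ + m) (resolution c x)) ⟩
    ∑[ c < ρ ] (h c *ℤ + α)
      ≡⟨ sym (*-distribʳ-sum (+ α) h) ⟩
    sum h *ℤ + α
      ≡⟨ cong (_*ℤ + α) balanced ⟩
    0ℤ ∎

alternating : ∀ {n} → Fin n → ℤ
alternating zero    = 1ℤ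
alternating (suc c) = - alternating c

∣alternating∣≡1 : ∀ {n} (c : Fin n) → ∣ alternating c ∣ ≡ 1
∣alternating∣≡1 zero    = refl
∣alternating∣≡1 (suc c) = trans (ℤ.∣-i∣≡∣i∣ (alternating c)) (∣alternating∣≡1 c)

sum-alternating : ∀ q → sum (alternating {q * 2}) ≡ 0ℤ
sum-alternating zero    = refl
sum-alternating (suc q) = cong (λ s → 1ℤ +ℤ (- 1ℤ +ℤ s)) (begin
  ∑[ c < q * 2 ] (- - alternating c) ≡⟨ sum-cong-≗ {q * 2} (λ c → ℤ.neg-involutive (alternating c)) ⟩
  sum (alternating {q * 2})         ≡⟨ sum-alternating q ⟩
  0ℤ                                ∎)

even-weighting : ∀ {ρ} → 2 ∣ ρ → Σ (Fin ρ → ℤ) (IsZeroSumWeighting 2 ρ)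
even-weighting (divides q refl) =
  alternating , (λ c → ℕ.≤-reflexive (sym (∣alternating∣≡1 c)) , ℕ.≤-reflexive (∣alternating∣≡1 c)) , sum-alternating q

odd-weights : ∀ {n} → Fin n → ℤ
odd-weights zero                = - + 2
odd-weights (suc zero)          = 1ℤ
odd-weights (suc (suc zero))    = 1ℤ
odd-weights (suc (suc (suc c))) = alternating c

odd-weights-bounded : ∀ {n} (c : Fin n) → (1 ≤ ∣ odd-weights c ∣) × (∣ odd-weights c ∣ ≤ 2)
odd-weights-bounded zero                = s≤s z≤n , s≤s (s≤s z≤n)
odd-weights-bounded (suc zero)          = s≤s z≤n , s≤s z≤n
odd-weights-bounded (suc (suc zero))    = s≤s z≤n , s≤s z≤n
odd-weights-bounded (suc (suc (suc c))) rewrite ∣alternating∣≡1 c = s≤s z≤n , s≤s z≤n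

sum-odd-weights : ∀ q → sum (odd-weights {3 + q * 2}) ≡ 0ℤ
sum-odd-weights q = cong (λ s → - + 2 +ℤ (1ℤ +ℤ (1ℤ +ℤ s))) (sum-alternating q)

odd≡1+[n/2]*2 : ∀ n → ¬ 2 ∣ n → n ≡ suc (n / 2 * 2)
odd≡1+[n/2]*2 n 2∤n with n % 2 | m≡m%n+[m/n]*n n 2 | m%n<n n 2
... | 0           | n≡[n/2]*2 | _ = ⊥-elim (2∤n (divides (n / 2) n≡[n/2]*2))
... | 1           | n≡1+[n/2]*2 | _ = n≡1+[n/2]*2
... | suc (suc _) | _ | s≤s (s≤s ())

odd-weighting : ∀ {ρ} → 1 < ρ → ¬ 2 ∣ ρ → Σ (Fin ρ → ℤ) (IsZeroSumWeighting 3 ρ)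
odd-weighting {ρ} 1<ρ 2∤ρ with ρ / 2 | odd≡1+[n/2]*2 ρ 2∤ρ
... | zero  | refl = ⊥-elim (ℕ.<-irrefl refl 1<ρ)
... | suc q | refl = odd-weights , odd-weights-bounded , sum-odd-weights q

mainTheorem11 : (v k λ' r α ρ b : ℕ) (B : Fin b → Subset v) (cls : Fin b → Fin ρ) →
    Is2Design v k λ' b B → HasReplication v b r B →
    1 ≤ α → IsAlphaResolution v b α ρ B cls → ρ * α ≡ r →
    ((1 < ρ × ¬ (2 ∣ ρ)) → Σ (Fin b → ℤ) (IsZeroSumFlow 3 v b B)) ×
    (2 ∣ ρ → Σ (Fin b → ℤ) (IsZeroSumFlow 2 v b B))
mainTheorem11 v k λ' r α ρ b B cls _ _ _ resolution _ =
  (λ (1<ρ , 2∤ρ) → lift {3} (odd-weighting 1<ρ 2∤ρ)) , (λ 2∣ρ → lift {2} (even-weighting 2∣ρ))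
  where
  lift : ∀ {n} → Σ (Fin ρ → ℤ) (IsZeroSumWeighting n ρ) → Σ (Fin b → ℤ) (IsZeroSumFlow n v b B)
  lift {n} (h , weighting) = (λ j → h (cls j)) , resolution-weighting⇒flow {n} B cls resolution weighting
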